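{- For all $n,m\ge0$, \[ \mathcal{L}(P_n(x)Q_m(x))=\begin{cases}0,& n<m,\\ a_{m+1}a_{m+2}\cdots a_n,& n\ge m\end{cases} \] (an empty product being $1$). In particular, $\mathcal{L}(P_n(x)Q_m(x))=\delta_{n,m}$ for $0\le n\le m$; $\mathcal{L}(P_n(x))=a_1a_2\cdots a_n$; and $\mathcal{L}\big(P_n(x)(Q_m(x)-a_{m+1}Q_{m+1}(x))\big)=\delta_{n,m}$.
   Context: Let $\{b_n\}_{n\ge0},\{a_n\}_{n\ge0},\{\lambda_n\}_{n\ge0}$ be sequences of complex numbers. Define monic polynomials $P_n(x)$ by $P_{ -1}(x)=0$, $P_0(x)=1$ and $P_{n+1}(x)=(x-b_n)P_n(x)-(a_nx+\lambda_n)P_{n-1}(x)$ for $n\ge0$. Let $d_0(x)=1$, $d_m(x)=\prod_{i=1}^m(a_ix+\lambda_i)$, and $Q_m(x)=P_m(x)/d_m(x)$. Assume $a_n\neq0$ and $P_n(-\lambda_n/a_n)\neq 0$ for all $n\ge1$. Let $V=\mathrm{span}\{x^nQ_m(x):n,m\ge0\}$ (rational functions), and let $\mathcal{L}$ be the unique linear functional on $V$ with $\mathcal{L}(1)=1$ and $\mathcal{L}(x^nQ_m(x))=0$ whenever $0\le n<m$. -}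

module Defs where

open import Level using (Level; _⊔_)
open import Algebra.Bundles using (CommutativeRing)
open import Data.Nat using (ℕ; zero; suc; _≡ᵇ_; _<_; _≤_)
open import Data.Bool using (if_then_else_)
open import Data.List using (List; []; _∷_; map)
open import Data.List.Relation.Unary.All using (All)
open import Data.Product using (Σ; _×_; _,_; proj₁; proj₂)
open import Relation.Nullary using (¬_)

record IsField {c ℓ : Level} (R : CommutativeRing c ℓ) : Set (c ⊔ ℓ) where
  open CommutativeRing R
  field
    1≉0     : ¬ (1# ≈ 0#)
    inverse : ∀ x → ¬ (x ≈ 0#) → Σ Carrier (λ y → x * y ≈ 1#)

module Over {c ℓ : Level} (R : CommutativeRing c ℓ) where
  open CommutativeRing R

  -- Polynomials over R: coefficient lists, lowest degree first.
  Poly : Set c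
  Poly = List Carrier

  infixl 6 _+P_
  infixl 7 _*P_

  _+P_ : Poly → Poly → Poly
  [] +P q = q
  (x ∷ p) +P [] = x ∷ p
  (x ∷ p) +P (y ∷ q) = (x + y) ∷ (p +P q)

  scaleP : Carrier → Poly → Poly
  scaleP k p = map (k *_) p

  negP : Poly → Poly
  negP p = map -_ p

  _*P_ : Poly → Poly → Poly
  [] *P q = []
  (x ∷ p) *P q = scaleP x q +P (0# ∷ (p *P q))

  constP : Carrier → Poly
  constP k = k ∷ []

  oneP : Poly
  oneP = constP 1#

  XP : Poly
  XP = 0# ∷ 1# ∷ []

  XP^ : ℕ → Poly
  XP^ zero = oneP
  XP^ (suc n) = XP *P XP^ n

  _≈P_ : Poly → Poly → Set (c ⊔ ℓ)
  p ≈P q = All (_≈ 0#) (p +P negP q)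

  evalP : Poly → Carrier → Carrier
  evalP [] x = 0#
  evalP (k ∷ p) x = k + x * evalP p x

  -- Rational functions: fractions num/den with equality by cross-multiplication.
  Frac : Set c
  Frac = Poly × Poly

  _≈F_ : Frac → Frac → Set (c ⊔ ℓ)
  (p , q) ≈F (r , s) = (p *P s) ≈P (r *P q)

  _+F_ : Frac → Frac → Frac
  (p , q) +F (r , s) = ((p *P s) +P (r *P q)) , (q *P s)

  _*F_ : Frac → Frac → Frac
  (p , q) *F (r , s) = (p *P r) , (q *P s)

  scaleF : Carrier → Frac → Frac
  scaleF k (p , q) = scaleP k p , q

  zeroF : Frac
  zeroF = [] , oneP

  oneF : Frac
  oneF = oneP , oneP

  polyF : Poly → Frac
  polyF p = p , oneP

  module Recurrence (b a lam : ℕ → Carrier) where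

    linP : ℕ → Poly
    linP i = lam i ∷ a i ∷ []

    -- (P_n , P_{n+1}), with P_{-1} = 0, P_0 = 1,
    -- P_{n+1} = (x - b_n) P_n - (a_n x + λ_n) P_{n-1}
    Ps : ℕ → Poly × Poly
    Ps zero = oneP , (((XP +P constP (- b 0)) *P oneP) +P negP (linP 0 *P []))
    Ps (suc n) =
      let p = proj₁ (Ps n) ; q = proj₂ (Ps n)
      in q , (((XP +P constP (- b (suc n))) *P q) +P negP (linP (suc n) *P p))

    P : ℕ → Poly
    P n = proj₁ (Ps n)

    d : ℕ → Poly
    d zero = oneP
    d (suc m) = d m *P linP (suc m)

    Q : ℕ → Frac
    Q m = P m , d m

    gen : ℕ → ℕ → Frac
    gen n m = (XP^ n *P P m) , d m

    -- elements of V: finite linear combinations Σ c_i x^{n_i} Q_{m_i}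
    Comb : Set c
    Comb = List (Carrier × ℕ × ℕ)

    ⟦_⟧ : Comb → Frac
    ⟦ [] ⟧ = zeroF
    ⟦ (k , n , m) ∷ cs ⟧ = scaleF k (gen n m) +F ⟦ cs ⟧

    record LinearFunctional : Set (c ⊔ ℓ) where
      field
        L      : Comb → Carrier
        wd     : ∀ cs ds → ⟦ cs ⟧ ≈F ⟦ ds ⟧ → L cs ≈ L ds
        linear : ∀ k cs ds es →
                 ⟦ es ⟧ ≈F (scaleF k ⟦ cs ⟧ +F ⟦ ds ⟧) →
                 L es ≈ (k * L cs) + L ds

    record IsMomentFunctional (F : LinearFunctional) : Set (c ⊔ ℓ) where
      open LinearFunctional F
      field
        L-one  : ∀ cs → ⟦ cs ⟧ ≈F oneF → L cs ≈ 1#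
        L-orth : ∀ n m → n < m → ∀ cs → ⟦ cs ⟧ ≈F gen n m → L cs ≈ 0#

    prodA : ℕ → ℕ → Carrier
    prodA m zero = 1#
    prodA m (suc k) = a (suc m) * prodA (suc m) k

    δ : ℕ → ℕ → Carrier
    δ n m = if n ≡ᵇ m then 1# else 0#

-- On the generators xⁿQ_m: the recurrence for P_{n+2}, divided by d_{n+1}, reads
--   x^{n+1}Q_{n+1} = xⁿQ_n + b_{n+1}xⁿQ_{n+1} + (a_{n+2}x + λ_{n+2})xⁿQ_{n+2},
-- and the last two generators are orthogonal, so 𝓛(xⁿQ_n) = 𝓛(Q_0) = 1.  By linearity 𝓛(pQ_N)
-- is then the coefficient of x^N in p whenever deg p ≤ N.  As P_n is monic of degree n, this
-- gives 𝓛(P_nQ_m) = δ_{nm} for n ≤ m; for n = m + k write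
--   P_{m+k}Q_m = P_m(a_{m+1}x + λ_{m+1})⋯(a_{m+k}x + λ_{m+k})Q_{m+k},
-- whose polynomial factor has degree m + k and leading coefficient a_{m+1}⋯a_{m+k}.  The last
-- claim combines the cases m and m + 1 linearly.
module Submission where

open import Level using (Level; _⊔_)
open import Algebra.Bundles using (CommutativeRing)
import Algebra.Solver.Ring
open import Algebra.Solver.Ring.AlmostCommutativeRing
  using (_-Raw-AlmostCommutative⟶_; fromCommutativeRing)
open import Data.Empty using (⊥-elim)
open import Data.Integer as ℤ using (ℤ; +_; -[1+_])
open import Data.Integer.Properties as ℤ using ()
open import Data.List using ([]; _∷_; length)
open import Data.List.Properties using (length-map)
open import Data.List.Relation.Unary.All using (All; []; _∷_)
open import Data.Maybe using (Maybe; just; nothing)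
open import Data.Nat as ℕ using (ℕ; zero; suc; _≤_; _<_; z≤n; s≤s)
open import Data.Nat.Properties as ℕ using ()
open import Data.Product using (_×_; _,_; proj₁; proj₂)
open import Data.Sign as Sign using (Sign)
open import Data.Sum using (inj₁; inj₂)
open import Function using (_∘_)
open import Relation.Binary.Definitions using (tri<; tri≈; tri>)
open import Relation.Binary.PropositionalEquality as ≡ using (_≡_; _≢_)
import Relation.Binary.Reasoning.Setoid as SetoidReasoning
open import Relation.Nullary using (¬_; yes; no)

open import Defs

-- The ring solver of the standard library needs coefficients whose arithmetic computes;
-- integers serve in every commutative ring through the canonical map ℤ → S.
module IntegerCoefficients {c ℓ : Level} (S : CommutativeRing c ℓ) where
  open CommutativeRing S
  open import Algebra.Properties.Semiring.Mult semiring using (×-homo-+; ×1-homo-*)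
    renaming (_×_ to _×′_)
  open import Algebra.Properties.Ring ring
    using (-‿involutive; -0#≈0#; -‿distribˡ-*; -‿distribʳ-*; -‿+-comm)
  open import Algebra.Properties.CommutativeSemigroup +-commutativeSemigroup using (interchange)
  open import Relation.Binary.Reasoning.Setoid setoid

  ⟦_⟧ℤ : ℤ → Carrier
  ⟦ + n ⟧ℤ      = n ×′ 1#
  ⟦ -[1+ n ] ⟧ℤ = - (suc n ×′ 1#)

  ⟦⊖⟧ : ∀ m n → ⟦ m ℤ.⊖ n ⟧ℤ ≈ m ×′ 1# - n ×′ 1#
  ⟦⊖⟧ zero    zero    = sym (trans (+-identityˡ _) -0#≈0#)
  ⟦⊖⟧ zero    (suc n) = sym (+-identityˡ _)
  ⟦⊖⟧ (suc m) zero    = sym (trans (+-congˡ -0#≈0#) (+-identityʳ _))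
  ⟦⊖⟧ (suc m) (suc n) = begin
    ⟦ suc m ℤ.⊖ suc n ⟧ℤ                  ≡⟨ ≡.cong ⟦_⟧ℤ (ℤ.[1+m]⊖[1+n]≡m⊖n m n) ⟩
    ⟦ m ℤ.⊖ n ⟧ℤ                          ≈⟨ ⟦⊖⟧ m n ⟩
    m ×′ 1# - n ×′ 1#                     ≈⟨ +-identityˡ _ ⟨
    0# + (m ×′ 1# - n ×′ 1#)              ≈⟨ +-congʳ (-‿inverseʳ 1#) ⟨
    (1# - 1#) + (m ×′ 1# - n ×′ 1#)       ≈⟨ interchange _ _ _ _ ⟩
    (1# + m ×′ 1#) + (- 1# + - n ×′ 1#)   ≈⟨ +-congˡ (-‿+-comm 1# _) ⟩
    (1# + m ×′ 1#) - (1# + n ×′ 1#)       ∎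

  +-homo : ∀ i j → ⟦ i ℤ.+ j ⟧ℤ ≈ ⟦ i ⟧ℤ + ⟦ j ⟧ℤ
  +-homo (+ m)    (+ n)    = ×-homo-+ 1# m n
  +-homo (+ m)    -[1+ n ] = ⟦⊖⟧ m (suc n)
  +-homo -[1+ m ] (+ n)    = trans (⟦⊖⟧ n (suc m)) (+-comm _ _)
  +-homo -[1+ m ] -[1+ n ] = begin
    - (suc (suc (m ℕ.+ n)) ×′ 1#)       ≡⟨ ≡.cong (λ k → - (suc k ×′ 1#)) (ℕ.+-suc m n) ⟨
    - ((suc m ℕ.+ suc n) ×′ 1#)         ≈⟨ -‿cong (×-homo-+ 1# (suc m) (suc n)) ⟩
    - (suc m ×′ 1# + suc n ×′ 1#)       ≈⟨ -‿+-comm _ _ ⟨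
    - (suc m ×′ 1#) + - (suc n ×′ 1#)     ∎

  signed : Sign → Carrier → Carrier
  signed Sign.+ x = x
  signed Sign.- x = - x

  ⟦◃⟧ : ∀ s n → ⟦ s ℤ.◃ n ⟧ℤ ≈ signed s (n ×′ 1#)
  ⟦◃⟧ Sign.+ zero    = refl
  ⟦◃⟧ Sign.- zero    = sym -0#≈0#
  ⟦◃⟧ Sign.+ (suc n) = refl
  ⟦◃⟧ Sign.- (suc n) = refl

  signed-* : ∀ s t x y → signed (s Sign.* t) (x * y) ≈ signed s x * signed t y
  signed-* Sign.+ Sign.+ x y = refl
  signed-* Sign.+ Sign.- x y = -‿distribʳ-* x y
  signed-* Sign.- Sign.+ x y = -‿distribˡ-* x y
  signed-* Sign.- Sign.- x y = begin
    x * y              ≈⟨ -‿involutive _ ⟨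
    - - (x * y)        ≈⟨ -‿cong (-‿distribˡ-* x y) ⟩
    - (- x * y)        ≈⟨ -‿distribʳ-* (- x) y ⟩
    - x * - y          ∎

  signed-cong : ∀ s {x y} → x ≈ y → signed s x ≈ signed s y
  signed-cong Sign.+ e = e
  signed-cong Sign.- e = -‿cong e

  ⟦⟧ℤ-signed : ∀ i → ⟦ i ⟧ℤ ≈ signed (ℤ.sign i) (ℤ.∣ i ∣ ×′ 1#)
  ⟦⟧ℤ-signed (+ n)    = refl
  ⟦⟧ℤ-signed -[1+ n ] = refl

  *-homo : ∀ i j → ⟦ i ℤ.* j ⟧ℤ ≈ ⟦ i ⟧ℤ * ⟦ j ⟧ℤ
  *-homo i j = begin
    ⟦ i ℤ.* j ⟧ℤ                                    ≈⟨ ⟦◃⟧ (s Sign.* t) (∣i∣ ℕ.* ∣j∣) ⟩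
    signed (s Sign.* t) ((∣i∣ ℕ.* ∣j∣) ×′ 1#)       ≈⟨ signed-cong (s Sign.* t) (×1-homo-* ∣i∣ ∣j∣) ⟩
    signed (s Sign.* t) ((∣i∣ ×′ 1#) * (∣j∣ ×′ 1#)) ≈⟨ signed-* s t _ _ ⟩
    signed s (∣i∣ ×′ 1#) * signed t (∣j∣ ×′ 1#)     ≈⟨ *-cong (⟦⟧ℤ-signed i) (⟦⟧ℤ-signed j) ⟨
    ⟦ i ⟧ℤ * ⟦ j ⟧ℤ                                 ∎
    where
    s t : Sign
    s = ℤ.sign i
    t = ℤ.sign j
    ∣i∣ ∣j∣ : ℕ
    ∣i∣ = ℤ.∣ i ∣
    ∣j∣ = ℤ.∣ j ∣

  -‿homo : ∀ i → ⟦ ℤ.- i ⟧ℤ ≈ - ⟦ i ⟧ℤ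
  -‿homo (+ zero)  = sym -0#≈0#
  -‿homo (+ suc n) = refl
  -‿homo -[1+ n ]  = sym (-‿involutive _)

  ℤ⟶S : ℤ.+-*-rawRing -Raw-AlmostCommutative⟶ fromCommutativeRing S
  ℤ⟶S = record
    { ⟦_⟧ = ⟦_⟧ℤ ; +-homo = +-homo ; *-homo = *-homo ; -‿homo = -‿homo
    ; 0-homo = refl ; 1-homo = +-identityʳ 1# }

  ⟦⟧ℤ-≟ : ∀ i j → Maybe (⟦ i ⟧ℤ ≈ ⟦ j ⟧ℤ)
  ⟦⟧ℤ-≟ i j with i ℤ.≟ j
  ... | yes ≡.refl = just refl
  ... | no _       = nothing

  open Algebra.Solver.Ring ℤ.+-*-rawRing (fromCommutativeRing S) ℤ⟶S ⟦⟧ℤ-≟ public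

module Polynomials {c ℓ : Level} (R : CommutativeRing c ℓ) where
  open CommutativeRing R hiding (zero)
  open Over R
  open import Algebra.Properties.Ring ring using (-0#≈0#)
  open import Algebra.Properties.CommutativeSemigroup +-commutativeSemigroup
    using (interchange; x∙yz≈y∙xz)

  private variable
    p p′ q q′ r : Poly
    x y k l : Carrier

  coeff : Poly → ℕ → Carrier
  coeff []      i       = 0#
  coeff (x ∷ p) zero    = x
  coeff (x ∷ p) (suc i) = coeff p i

  infix 4 _≋_
  record _≋_ (p q : Poly) : Set ℓ where
    constructor mk≋
    field coeff-≈ : ∀ i → coeff p i ≈ coeff q i
  open _≋_ public

  ≋-refl : p ≋ p
  ≋-refl = mk≋ λ _ → refl

  ≋-sym : p ≋ q → q ≋ p
  ≋-sym e = mk≋ λ i → sym (coeff-≈ e i)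

  ≋-trans : p ≋ q → q ≋ r → p ≋ r
  ≋-trans e e′ = mk≋ λ i → trans (coeff-≈ e i) (coeff-≈ e′ i)

  ≡⇒≋ : p ≡ q → p ≋ q
  ≡⇒≋ ≡.refl = ≋-refl

  ∷-cong : x ≈ y → p ≋ q → x ∷ p ≋ y ∷ q
  ∷-cong e e′ = mk≋ λ { zero → e ; (suc i) → coeff-≈ e′ i }

  ∷-injectiveʳ : x ∷ p ≋ y ∷ q → p ≋ q
  ∷-injectiveʳ e = mk≋ λ i → coeff-≈ e (suc i)

  ∷-≋[] : x ≈ 0# → p ≋ [] → x ∷ p ≋ []
  ∷-≋[] e e′ = mk≋ λ { zero → e ; (suc i) → coeff-≈ e′ i }

  0∷[]≋[] : 0# ∷ [] ≋ []
  0∷[]≋[] = ∷-≋[] refl ≋-refl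

  coeff-+P : ∀ p q i → coeff (p +P q) i ≈ coeff p i + coeff q i
  coeff-+P []      q       i       = sym (+-identityˡ _)
  coeff-+P (x ∷ p) []      i       = sym (+-identityʳ _)
  coeff-+P (x ∷ p) (y ∷ q) zero    = refl
  coeff-+P (x ∷ p) (y ∷ q) (suc i) = coeff-+P p q i

  coeff-scaleP : ∀ k p i → coeff (scaleP k p) i ≈ k * coeff p i
  coeff-scaleP k []      i       = sym (zeroʳ k)
  coeff-scaleP k (x ∷ p) zero    = refl
  coeff-scaleP k (x ∷ p) (suc i) = coeff-scaleP k p i

  coeff-negP : ∀ p i → coeff (negP p) i ≈ - coeff p i
  coeff-negP []      i       = sym -0#≈0#
  coeff-negP (x ∷ p) zero    = refl
  coeff-negP (x ∷ p) (suc i) = coeff-negP p i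

  +P-cong : p ≋ p′ → q ≋ q′ → p +P q ≋ p′ +P q′
  +P-cong {p} {p′} {q} {q′} e e′ = mk≋ λ i → begin
    coeff (p +P q) i         ≈⟨ coeff-+P p q i ⟩
    coeff p i + coeff q i    ≈⟨ +-cong (coeff-≈ e i) (coeff-≈ e′ i) ⟩
    coeff p′ i + coeff q′ i  ≈⟨ coeff-+P p′ q′ i ⟨
    coeff (p′ +P q′) i       ∎
    where open SetoidReasoning setoid

  +P-congˡ : ∀ p → q ≋ q′ → p +P q ≋ p +P q′
  +P-congˡ p = +P-cong (≋-refl {p})

  +P-congʳ : ∀ q → p ≋ p′ → p +P q ≋ p′ +P q
  +P-congʳ q e = +P-cong e (≋-refl {q})

  +P-comm : ∀ p q → p +P q ≋ q +P p
  +P-comm p q = mk≋ λ i →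
    trans (coeff-+P p q i) (trans (+-comm _ _) (sym (coeff-+P q p i)))

  +P-assoc : ∀ p q r → (p +P q) +P r ≋ p +P (q +P r)
  +P-assoc p q r = mk≋ λ i → begin
    coeff ((p +P q) +P r) i                ≈⟨ coeff-+P (p +P q) r i ⟩
    coeff (p +P q) i + coeff r i           ≈⟨ +-congʳ (coeff-+P p q i) ⟩
    (coeff p i + coeff q i) + coeff r i    ≈⟨ +-assoc _ _ _ ⟩
    coeff p i + (coeff q i + coeff r i)    ≈⟨ +-congˡ (coeff-+P q r i) ⟨
    coeff p i + coeff (q +P r) i           ≈⟨ coeff-+P p (q +P r) i ⟨
    coeff (p +P (q +P r)) i                ∎
    where open SetoidReasoning setoid

  +P-interchange : ∀ p q r s → (p +P q) +P (r +P s) ≋ (p +P r) +P (q +P s)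
  +P-interchange p q r s = mk≋ λ i → begin
    coeff ((p +P q) +P (r +P s)) i                          ≈⟨ coeff-+P (p +P q) (r +P s) i ⟩
    coeff (p +P q) i + coeff (r +P s) i                     ≈⟨ +-cong (coeff-+P p q i) (coeff-+P r s i) ⟩
    (coeff p i + coeff q i) + (coeff r i + coeff s i)       ≈⟨ interchange _ _ _ _ ⟩
    (coeff p i + coeff r i) + (coeff q i + coeff s i)       ≈⟨ +-cong (coeff-+P p r i) (coeff-+P q s i) ⟨
    coeff (p +P r) i + coeff (q +P s) i                     ≈⟨ coeff-+P (p +P r) (q +P s) i ⟨
    coeff ((p +P r) +P (q +P s)) i                          ∎
    where open SetoidReasoning setoid

  +P-swap : ∀ p q r → p +P (q +P r) ≋ q +P (p +P r)
  +P-swap p q r = mk≋ λ i → begin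
    coeff (p +P (q +P r)) i                ≈⟨ coeff-+P p (q +P r) i ⟩
    coeff p i + coeff (q +P r) i           ≈⟨ +-congˡ (coeff-+P q r i) ⟩
    coeff p i + (coeff q i + coeff r i)    ≈⟨ x∙yz≈y∙xz _ _ _ ⟩
    coeff q i + (coeff p i + coeff r i)    ≈⟨ +-congˡ (coeff-+P p r i) ⟨
    coeff q i + coeff (p +P r) i           ≈⟨ coeff-+P q (p +P r) i ⟨
    coeff (q +P (p +P r)) i                ∎
    where open SetoidReasoning setoid

  +P-identityʳ : ∀ p → p +P [] ≋ p
  +P-identityʳ p = mk≋ λ i → trans (coeff-+P p [] i) (+-identityʳ _)

  negP-cong : p ≋ q → negP p ≋ negP q
  negP-cong {p} {q} e = mk≋ λ i →
    trans (coeff-negP p i) (trans (-‿cong (coeff-≈ e i)) (sym (coeff-negP q i)))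

  negP-inverseˡ : ∀ p → negP p +P p ≋ []
  negP-inverseˡ p = mk≋ λ i →
    trans (coeff-+P (negP p) p i) (trans (+-congʳ (coeff-negP p i)) (-‿inverseˡ _))

  negP-inverseʳ : ∀ p → p +P negP p ≋ []
  negP-inverseʳ p = ≋-trans (+P-comm p (negP p)) (negP-inverseˡ p)

  scaleP-cong : x ≈ y → p ≋ q → scaleP x p ≋ scaleP y q
  scaleP-cong {x} {y} {p} {q} e e′ = mk≋ λ i →
    trans (coeff-scaleP x p i) (trans (*-cong e (coeff-≈ e′ i)) (sym (coeff-scaleP y q i)))

  scaleP-distribˡ : ∀ k p q → scaleP k (p +P q) ≋ scaleP k p +P scaleP k q
  scaleP-distribˡ k p q = mk≋ λ i → begin
    coeff (scaleP k (p +P q)) i                        ≈⟨ coeff-scaleP k (p +P q) i ⟩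
    k * coeff (p +P q) i                               ≈⟨ *-congˡ (coeff-+P p q i) ⟩
    k * (coeff p i + coeff q i)                        ≈⟨ distribˡ k _ _ ⟩
    k * coeff p i + k * coeff q i
      ≈⟨ +-cong (coeff-scaleP k p i) (coeff-scaleP k q i) ⟨
    coeff (scaleP k p) i + coeff (scaleP k q) i        ≈⟨ coeff-+P (scaleP k p) (scaleP k q) i ⟨
    coeff (scaleP k p +P scaleP k q) i                 ∎
    where open SetoidReasoning setoid

  scaleP-distribʳ : ∀ k l p → scaleP (k + l) p ≋ scaleP k p +P scaleP l p
  scaleP-distribʳ k l p = mk≋ λ i → begin
    coeff (scaleP (k + l) p) i                         ≈⟨ coeff-scaleP (k + l) p i ⟩
    (k + l) * coeff p i                                ≈⟨ distribʳ _ k l ⟩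
    k * coeff p i + l * coeff p i
      ≈⟨ +-cong (coeff-scaleP k p i) (coeff-scaleP l p i) ⟨
    coeff (scaleP k p) i + coeff (scaleP l p) i        ≈⟨ coeff-+P (scaleP k p) (scaleP l p) i ⟨
    coeff (scaleP k p +P scaleP l p) i                 ∎
    where open SetoidReasoning setoid

  scaleP-assoc : ∀ k l p → scaleP k (scaleP l p) ≋ scaleP (k * l) p
  scaleP-assoc k l p = mk≋ λ i → begin
    coeff (scaleP k (scaleP l p)) i    ≈⟨ coeff-scaleP k (scaleP l p) i ⟩
    k * coeff (scaleP l p) i           ≈⟨ *-congˡ (coeff-scaleP l p i) ⟩
    k * (l * coeff p i)                ≈⟨ *-assoc k l _ ⟨
    (k * l) * coeff p i                ≈⟨ coeff-scaleP (k * l) p i ⟨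
    coeff (scaleP (k * l) p) i         ∎
    where open SetoidReasoning setoid

  scaleP-zero : ∀ p → scaleP 0# p ≋ []
  scaleP-zero p = mk≋ λ i → trans (coeff-scaleP 0# p i) (zeroˡ _)

  scaleP-identity : ∀ p → scaleP 1# p ≋ p
  scaleP-identity p = mk≋ λ i → trans (coeff-scaleP 1# p i) (*-identityˡ _)

  *P-congˡ : ∀ p → q ≋ q′ → p *P q ≋ p *P q′
  *P-congˡ []      e = ≋-refl
  *P-congˡ (x ∷ p) e = +P-cong (scaleP-cong refl e) (∷-cong refl (*P-congˡ p e))

  *P-zero-≋ : ∀ p q → p ≋ [] → p *P q ≋ []
  *P-zero-≋ []      q e = ≋-refl
  *P-zero-≋ (x ∷ p) q e = ≋-trans
    (+P-cong (≋-trans (scaleP-cong (coeff-≈ e zero) ≋-refl) (scaleP-zero q))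
             (∷-cong refl (*P-zero-≋ p q (mk≋ λ i → coeff-≈ e (suc i)))))
    0∷[]≋[]

  *P-congʳ : ∀ q → p ≋ p′ → p *P q ≋ p′ *P q
  *P-congʳ {p} {p′} q = go p p′
    where
    go : ∀ p p′ → p ≋ p′ → p *P q ≋ p′ *P q
    go []      p′       e = ≋-sym (*P-zero-≋ p′ q (≋-sym e))
    go (x ∷ p) []       e = *P-zero-≋ (x ∷ p) q e
    go (x ∷ p) (y ∷ p′) e =
      +P-cong (scaleP-cong (coeff-≈ e zero) ≋-refl) (∷-cong refl (go p p′ (∷-injectiveʳ e)))

  *P-cong : p ≋ p′ → q ≋ q′ → p *P q ≋ p′ *P q′
  *P-cong {p′ = p′} {q} e e′ = ≋-trans (*P-congʳ q e) (*P-congˡ p′ e′)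

  *P-zeroʳ : ∀ p → p *P [] ≋ []
  *P-zeroʳ []      = ≋-refl
  *P-zeroʳ (x ∷ p) = ≋-trans (∷-cong refl (*P-zeroʳ p)) 0∷[]≋[]

  scaleP-*P : ∀ k p q → scaleP k p *P q ≋ scaleP k (p *P q)
  scaleP-*P k []      q = ≋-refl
  scaleP-*P k (x ∷ p) q = ≋-trans
    (+P-cong (≋-sym (scaleP-assoc k x q)) (∷-cong (sym (zeroʳ k)) (scaleP-*P k p q)))
    (≋-sym (scaleP-distribˡ k (scaleP x q) (0# ∷ p *P q)))

  0∷-*P : ∀ p q → (0# ∷ p) *P q ≋ 0# ∷ p *P q
  0∷-*P p q = +P-cong (scaleP-zero q) ≋-refl

  *P-distribʳ : ∀ p q r → (p +P q) *P r ≋ p *P r +P q *P r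
  *P-distribʳ []      q       r = ≋-refl
  *P-distribʳ (x ∷ p) []      r = ≋-sym (+P-identityʳ _)
  *P-distribʳ (x ∷ p) (y ∷ q) r = ≋-trans
    (+P-cong (scaleP-distribʳ x y r)
             (∷-cong (sym (+-identityʳ 0#)) (*P-distribʳ p q r)))
    (+P-interchange (scaleP x r) (scaleP y r) (0# ∷ p *P r) (0# ∷ q *P r))

  *P-assoc : ∀ p q r → (p *P q) *P r ≋ p *P (q *P r)
  *P-assoc []      q r = ≋-refl
  *P-assoc (x ∷ p) q r = ≋-trans (*P-distribʳ (scaleP x q) (0# ∷ p *P q) r)
    (+P-cong (scaleP-*P x q r) (≋-trans (0∷-*P (p *P q) r) (∷-cong refl (*P-assoc p q r))))

  *P-∷ʳ : ∀ p y q → p *P (y ∷ q) ≋ scaleP y p +P (0# ∷ p *P q)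
  *P-∷ʳ []      y q = ≋-sym 0∷[]≋[]
  *P-∷ʳ (x ∷ p) y q = ∷-cong (+-congʳ (*-comm x y))
    (≋-trans (+P-cong ≋-refl (*P-∷ʳ p y q)) (+P-swap (scaleP x q) (scaleP y p) (0# ∷ p *P q)))

  *P-comm : ∀ p q → p *P q ≋ q *P p
  *P-comm []      q = ≋-sym (*P-zeroʳ q)
  *P-comm (x ∷ p) q = ≋-trans (+P-cong ≋-refl (∷-cong refl (*P-comm p q))) (≋-sym (*P-∷ʳ q x p))

  *P-identityˡ : ∀ p → oneP *P p ≋ p
  *P-identityˡ p = ≋-trans (+P-cong (scaleP-identity p) 0∷[]≋[]) (+P-identityʳ p)

  polynomialRing : CommutativeRing c ℓ
  polynomialRing = record
    { Carrier = Poly ; _≈_ = _≋_ ; _+_ = _+P_ ; _*_ = _*P_ ; -_ = negP ; 0# = [] ; 1# = oneP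
    ; isCommutativeRing = record
      { isRing = record
        { +-isAbelianGroup = record
          { isGroup = record
            { isMonoid = record
              { isSemigroup = record
                { isMagma = record
                  { isEquivalence = record { refl = ≋-refl ; sym = ≋-sym ; trans = ≋-trans }
                  ; ∙-cong = +P-cong }
                ; assoc = +P-assoc }
              ; identity = (λ _ → ≋-refl) , +P-identityʳ }
            ; inverse = negP-inverseˡ , negP-inverseʳ
            ; ⁻¹-cong = negP-cong }
          ; comm = +P-comm }
        ; *-cong = *P-cong
        ; *-assoc = *P-assoc
        ; *-identity = *P-identityˡ , λ p → ≋-trans (*P-comm p oneP) (*P-identityˡ p)
        ; distrib = (λ p q r → ≋-trans (*P-comm p (q +P r)) (≋-trans (*P-distribʳ q r p)
                                  (+P-cong (*P-comm q p) (*P-comm r p))))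
                  , (λ p q r → *P-distribʳ q r p) }
      ; *-comm = *P-comm } }

  module PolySolver = IntegerCoefficients polynomialRing
  open PolySolver using (solve; _:=_; _:+_; _:*_)
  module ≋-Reasoning = SetoidReasoning (CommutativeRing.setoid polynomialRing)
  open CommutativeRing polynomialRing public using () renaming (*-identityʳ to *P-identityʳ)

  open import Algebra.Properties.Ring (CommutativeRing.ring polynomialRing)
    using () renaming (x∙y⁻¹≈ε⇒x≈y to ≋-from-difference; x≈y⇒x∙y⁻¹≈ε to ≋-to-difference)

  All≈0⇒≋[] : All (_≈ 0#) p → p ≋ []
  All≈0⇒≋[] []       = ≋-refl
  All≈0⇒≋[] (e ∷ es) = ∷-≋[] e (All≈0⇒≋[] es)

  ≋[]⇒All≈0 : ∀ p → p ≋ [] → All (_≈ 0#) p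
  ≋[]⇒All≈0 []      e = []
  ≋[]⇒All≈0 (x ∷ p) e = coeff-≈ e zero ∷ ≋[]⇒All≈0 p (mk≋ λ i → coeff-≈ e (suc i))

  ≈P-intro : p +P negP q ≋ [] → p ≈P q
  ≈P-intro = ≋[]⇒All≈0 _

  ≈F-intro : ∀ f g → proj₁ f *P proj₂ g +P negP (proj₁ g *P proj₂ f) ≋ [] → f ≈F g
  ≈F-intro (N , D) (A , B) = ≈P-intro {N *P B} {A *P D}

  ≈P⇒≋ : ∀ p q → p ≈P q → p ≋ q
  ≈P⇒≋ p q e = ≋-from-difference p q (All≈0⇒≋[] e)

  ≋⇒≈P : p ≋ q → p ≈P q
  ≋⇒≈P {p} {q} e = ≈P-intro {p} {q} (≋-to-difference e)

  length-+P : ∀ p q → length (p +P q) ≤ length p ℕ.⊔ length q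
  length-+P []      q       = ℕ.≤-refl
  length-+P (x ∷ p) []      = ℕ.≤-refl
  length-+P (x ∷ p) (y ∷ q) = s≤s (length-+P p q)

  coeff-≥length : ∀ p {i} → length p ≤ i → coeff p i ≈ 0#
  coeff-≥length []      _       = refl
  coeff-≥length (x ∷ p) (s≤s h) = coeff-≥length p h

  -- p = k xⁿ + (terms of lower degree); k may be 0.
  record Leading (p : Poly) (n : ℕ) (k : Carrier) : Set ℓ where
    field
      length≤ : length p ≤ suc n
      coeff≈  : coeff p n ≈ k
  open Leading public

  private variable
    m n : ℕ

  Leading-≈ : k ≈ l → Leading p n k → Leading p n l
  Leading-≈ e h = record { length≤ = length≤ h ; coeff≈ = trans (coeff≈ h) e }

  Leading-short : ∀ p → length p ≤ n → Leading p n 0#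
  Leading-short p h = record { length≤ = ℕ.m≤n⇒m≤1+n h ; coeff≈ = coeff-≥length p h }

  Leading-∷ : Leading p n k → Leading (x ∷ p) (suc n) k
  Leading-∷ h = record { length≤ = s≤s (length≤ h) ; coeff≈ = coeff≈ h }

  Leading-∷⁻ : Leading (x ∷ p) (suc n) k → Leading p n k
  Leading-∷⁻ h = record { length≤ = ℕ.≤-pred (length≤ h) ; coeff≈ = coeff≈ h }

  Leading-+P : Leading p n k → Leading q n l → Leading (p +P q) n (k + l)
  Leading-+P {p} {n} {q = q} h h′ = record
    { length≤ = ℕ.≤-trans (length-+P p q) (ℕ.⊔-lub (length≤ h) (length≤ h′))
    ; coeff≈  = trans (coeff-+P p q n) (+-cong (coeff≈ h) (coeff≈ h′)) }

  Leading-negP : Leading p n k → Leading (negP p) n (- k)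
  Leading-negP {p} {n} h = record
    { length≤ = ℕ.≤-trans (ℕ.≤-reflexive (length-map -_ p)) (length≤ h)
    ; coeff≈  = trans (coeff-negP p n) (-‿cong (coeff≈ h)) }

  Leading-scaleP : Leading p n k → Leading (scaleP x p) n (x * k)
  Leading-scaleP {p} {n} {x = x} h = record
    { length≤ = ℕ.≤-trans (ℕ.≤-reflexive (length-map (x *_) p)) (length≤ h)
    ; coeff≈  = trans (coeff-scaleP x p n) (*-congˡ (coeff≈ h)) }

  Leading-*P : Leading p m k → Leading q n l → Leading (p *P q) (m ℕ.+ n) (k * l)
  Leading-*P {[]} {m} {k} {n = n} {l} h h′ = record
    { length≤ = z≤n ; coeff≈ = sym (trans (*-congʳ (sym (coeff≈ h))) (zeroˡ l)) }
  Leading-*P {x ∷ []} {zero} {q = q} {n} h h′ = Leading-≈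
    (trans (+-identityʳ _) (*-congʳ (coeff≈ h)))
    (Leading-+P (Leading-scaleP h′) (record { length≤ = s≤s z≤n ; coeff≈ = coeff-≈ 0∷[]≋[] n }))
  Leading-*P {x ∷ y ∷ p} {zero} h h′ with length≤ h
  ... | s≤s ()
  Leading-*P {x ∷ p} {suc m} {q = q} {n} h h′ = Leading-≈
    (+-identityˡ _)
    (Leading-+P (Leading-short (scaleP x q) (ℕ.≤-trans (ℕ.≤-reflexive (length-map (x *_) q))
                                                         (ℕ.≤-trans (length≤ h′) (s≤s (ℕ.m≤n+m n m)))))
                (Leading-∷ (Leading-*P (Leading-∷⁻ h) h′)))


  Leading-oneP : Leading oneP 0 1#
  Leading-oneP = record { length≤ = s≤s z≤n ; coeff≈ = refl }

  Leading-X+c : ∀ x → Leading (XP +P constP x) 1 1#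
  Leading-X+c x = record { length≤ = s≤s (s≤s z≤n) ; coeff≈ = refl }

  Leading-recurrence : ∀ x r → Leading r 1 k → Leading q n 1# → Leading p n 0# →
                       Leading ((XP +P constP x) *P q +P negP (r *P p)) (suc n) 1#
  Leading-recurrence {k} x r hr hq hp = Leading-≈ value
    (Leading-+P (Leading-*P (Leading-X+c x) hq) (Leading-negP (Leading-*P hr hp)))
    where
    open SetoidReasoning setoid
    value : 1# * 1# + - (k * 0#) ≈ 1#
    value = begin
      1# * 1# + - (k * 0#)   ≈⟨ +-cong (*-identityˡ 1#) (-‿cong (zeroʳ k)) ⟩
      1# + - 0#              ≈⟨ +-congˡ -0#≈0# ⟩
      1# + 0#                ≈⟨ +-identityʳ 1# ⟩
      1#                     ∎

  scaleP≋constP*P : ∀ k p → scaleP k p ≋ constP k *P p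
  scaleP≋constP*P k p = ≋-sym (≋-trans (+P-cong ≋-refl 0∷[]≋[]) (+P-identityʳ _))

  XP*P≋0∷ : ∀ p → XP *P p ≋ 0# ∷ p
  XP*P≋0∷ p = +P-cong (scaleP-zero p) (∷-cong refl (*P-identityˡ p))

  ∷≋constP+XP*P : ∀ x p → x ∷ p ≋ constP x +P XP *P p
  ∷≋constP+XP*P x p =
    ≋-sym (≋-trans (+P-congˡ (constP x) (XP*P≋0∷ p)) (∷-cong (+-identityʳ x) ≋-refl))

  -- Unlike ≈F, this relation is transitive over any commutative ring: no cancellation is involved.
  record _Expands_ (f g : Frac) : Set (c ⊔ ℓ) where
    constructor by-factor
    field
      factor : Poly
      num≋   : proj₁ f ≋ proj₁ g *P factor
      den≋   : proj₂ f ≋ proj₂ g *P factor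

  private variable
    f f′ g g′ h : Frac

  Expands-≋ : p ≋ p′ → q ≋ q′ → (p , q) Expands (p′ , q′)
  Expands-≋ e e′ =
    by-factor oneP (≋-trans e (≋-sym (*P-identityʳ _))) (≋-trans e′ (≋-sym (*P-identityʳ _)))

  Expands-refl : f Expands f
  Expands-refl = Expands-≋ ≋-refl ≋-refl

  Expands-trans : f Expands g → g Expands h → f Expands h
  Expands-trans {g = g} {h} (by-factor E n d) (by-factor E′ n′ d′) = by-factor (E′ *P E)
    (≋-trans n (≋-trans (*P-congʳ E n′) (*P-assoc (proj₁ h) E′ E)))
    (≋-trans d (≋-trans (*P-congʳ E d′) (*P-assoc (proj₂ h) E′ E)))

  scaleF-Expands : f Expands g → scaleF k f Expands scaleF k g
  scaleF-Expands {g = g} {k} (by-factor E n d) = by-factor E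
    (≋-trans (scaleP-cong refl n) (≋-sym (scaleP-*P k (proj₁ g) E))) d

  +F-Expands : f Expands g → f′ Expands g′ → (f +F f′) Expands (g +F g′)
  +F-Expands {g = A₁ , B₁} {g′ = A₂ , B₂} (by-factor E₁ n₁ d₁) (by-factor E₂ n₂ d₂) =
    by-factor (E₁ *P E₂)
      (≋-trans (+P-cong (*P-cong n₁ d₂) (*P-cong n₂ d₁))
        (solve 6 (λ A₁ B₁ A₂ B₂ E₁ E₂ → (A₁ :* E₁) :* (B₂ :* E₂) :+ (A₂ :* E₂) :* (B₁ :* E₁)
                                      := (A₁ :* B₂ :+ A₂ :* B₁) :* (E₁ :* E₂))
               ≋-refl A₁ B₁ A₂ B₂ E₁ E₂))
      (≋-trans (*P-cong d₁ d₂)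
        (solve 4 (λ B₁ B₂ E₁ E₂ → (B₁ :* E₁) :* (B₂ :* E₂) := (B₁ :* B₂) :* (E₁ :* E₂))
               ≋-refl B₁ B₂ E₁ E₂))

  ≈F-refl : ∀ f → f ≈F f
  ≈F-refl (p , q) = ≋⇒≈P (≋-refl {p *P q})

  ≈F-Expands : ∀ f → f ≈F g → h Expands g → f ≈F h
  ≈F-Expands {A , B} {H₁ , H₂} (N , D) f≈g (by-factor E n d) = ≋⇒≈P (begin
    N *P H₂          ≈⟨ *P-congˡ N d ⟩
    N *P (B *P E)    ≈⟨ *P-assoc N B E ⟨
    (N *P B) *P E    ≈⟨ *P-congʳ E (≈P⇒≋ (N *P B) (A *P D) f≈g) ⟩
    (A *P D) *P E    ≈⟨ solve 3 (λ A D E → (A :* D) :* E := (A :* E) :* D) ≋-refl A D E ⟩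
    (A *P E) *P D    ≈⟨ *P-congʳ D n ⟨
    H₁ *P D          ∎)
    where open ≋-Reasoning

  Expands-≈F : f Expands g → ∀ h → g ≈F h → f ≈F h
  Expands-≈F {F₁ , F₂} {A , B} (by-factor E n d) (N , D) g≈h = ≋⇒≈P (begin
    F₁ *P D          ≈⟨ *P-congʳ D n ⟩
    (A *P E) *P D    ≈⟨ solve 3 (λ A E D → (A :* E) :* D := (A :* D) :* E) ≋-refl A E D ⟩
    (A *P D) *P E    ≈⟨ *P-congʳ E (≈P⇒≋ (A *P D) (N *P B) g≈h) ⟩
    (N *P B) *P E    ≈⟨ *P-assoc N B E ⟩
    N *P (B *P E)    ≈⟨ *P-congˡ N d ⟨
    N *P F₂          ∎)
    where open ≋-Reasoning

module RecurrenceFacts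
  {c ℓ : Level} (R : CommutativeRing c ℓ) (b a lam : ℕ → CommutativeRing.Carrier R)
  where
  open CommutativeRing R hiding (zero)
  open Over R
  open Recurrence b a lam
  open Polynomials R

  Leading-linP : ∀ i → Leading (linP i) 1 (a i)
  Leading-linP i = record { length≤ = s≤s (s≤s z≤n) ; coeff≈ = refl }

  P-leading : ∀ n → Leading (P n) n 1#
  P-leading n = proj₁ (consecutive n)
    where
    consecutive : ∀ n → Leading (P n) n 1# × Leading (P (suc n)) (suc n) 1#
    consecutive zero    = Leading-oneP , Leading-recurrence (- b 0) (linP 0) (Leading-linP 0)
                                                             Leading-oneP (Leading-short [] z≤n)
    consecutive (suc n) with consecutive n
    ... | hₙ , hₙ₊₁ = hₙ₊₁ , Leading-recurrence (- b (suc n)) (linP (suc n)) (Leading-linP (suc n))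
                                               hₙ₊₁ (Leading-short (P n) (length≤ hₙ))

  linProd : ℕ → ℕ → Poly
  linProd m zero    = oneP
  linProd m (suc k) = linP (suc m) *P linProd (suc m) k

  linProd-leading : ∀ m k → Leading (linProd m k) k (prodA m k)
  linProd-leading m zero    = Leading-oneP
  linProd-leading m (suc k) = Leading-*P (Leading-linP (suc m)) (linProd-leading (suc m) k)

  d-*P-linProd : ∀ m k → d m *P linProd m k ≋ d (m ℕ.+ k)
  d-*P-linProd m zero    = ≋-trans (*P-identityʳ (d m)) (≡⇒≋ (≡.cong d (≡.sym (ℕ.+-identityʳ m))))
  d-*P-linProd m (suc k) = ≋-trans (≋-sym (*P-assoc (d m) (linP (suc m)) (linProd (suc m) k)))
    (≋-trans (d-*P-linProd (suc m) k) (≡⇒≋ (≡.cong d (≡.sym (ℕ.+-suc m k)))))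

  linP≋ : ∀ i → linP i ≋ constP (a i) *P XP +P constP (lam i)
  linP≋ i = ∷-cong (sym (trans (+-congʳ (trans (+-identityʳ _) (zeroʳ (a i)))) (+-identityˡ _)))
                   (∷-cong (sym (*-identityʳ (a i))) ≋-refl)

  δ-refl : ∀ n → δ n n ≈ 1#
  δ-refl zero    = refl
  δ-refl (suc n) = δ-refl n

  δ-≢ : ∀ {n m} → n ≢ m → δ n m ≈ 0#
  δ-≢ {zero}  {zero}  n≢m = ⊥-elim (n≢m ≡.refl)
  δ-≢ {zero}  {suc m} _   = refl
  δ-≢ {suc n} {zero}  _   = refl
  δ-≢ {suc n} {suc m} n≢m = δ-≢ (n≢m ∘ ≡.cong suc)

module MomentFunctional
  {c ℓ : Level} (R : CommutativeRing c ℓ) (b a lam : ℕ → CommutativeRing.Carrier R)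
  (F : Over.Recurrence.LinearFunctional R b a lam)
  (isM : Over.Recurrence.IsMomentFunctional R b a lam F)
  where
  open CommutativeRing R hiding (zero)
  open Over R
  open Recurrence b a lam
  open LinearFunctional F
  open IsMomentFunctional isM
  open Polynomials R
  open RecurrenceFacts R b a lam
  open PolySolver using (solve; _:=_; _:+_; _:*_; :-_; con)
  open import Algebra.Properties.Ring ring using (x+x≈x⇒x≈0; -‿distribˡ-*)

  term : Carrier → ℕ → ℕ → Frac
  term k n m = constP k *P (XP^ n *P P m) , d m

  recurrence-tail : ℕ → Frac
  recurrence-tail n = term (b (suc n)) n (suc n)
                   +F (term (a (2 ℕ.+ n)) (suc n) (2 ℕ.+ n)
                   +F (term (lam (2 ℕ.+ n)) n (2 ℕ.+ n)
                   +F zeroF))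

  Q-recurrence : ∀ n → gen (suc n) (suc n) ≈F (gen n n +F recurrence-tail n)
  Q-recurrence n = ≈F-intro lhs rhs (≋-trans difference (≋-trans (*P-congˡ K l₂-t≋[]) (*P-zeroʳ K)))
    where
    lhs rhs : Frac
    lhs = gen (suc n) (suc n)
    rhs = gen n n +F recurrence-tail n
    K t : Poly
    K = d (2 ℕ.+ n) *P XP^ n *P P (2 ℕ.+ n) *P d (suc n) *P d n *P d (suc n)
    t = constP (a (2 ℕ.+ n)) *P XP +P constP (lam (2 ℕ.+ n))
    l₂-t≋[] : linP (2 ℕ.+ n) +P negP t ≋ []
    l₂-t≋[] = ≋-trans (+P-congʳ (negP t) (linP≋ (2 ℕ.+ n))) (negP-inverseʳ t)
    -- Expanding P_{n+2} by its recurrence, the cross-multiplied difference becomes a multiple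
    -- of l₂ - t, where l₂ = a_{n+2} x + λ_{n+2} is kept as an opaque factor of d_{n+2}.
    difference : proj₁ lhs *P proj₂ rhs +P negP (proj₁ rhs *P proj₂ lhs)
                 ≋ K *P (linP (2 ℕ.+ n) +P negP t)
    difference = solve 10
      (λ X Y P₀ P₁ D l₁ l₂ A Λ B →
        let D₁ = D :* l₁ ; D₂ = D₁ :* l₂ ; U = con (+ 1)
            P₂ = (X :+ :- B) :* P₁ :+ :- (l₁ :* P₀)
            den₃ = D₂ :* U
            num₃ = (Λ :* (Y :* P₂)) :* U :+ con (+ 0)
            den₂ = D₂ :* den₃
            num₂ = (A :* ((X :* Y) :* P₂)) :* den₃ :+ num₃ :* D₂
            den₁ = D₁ :* den₂
            num₁ = (B :* (Y :* P₁)) :* den₂ :+ num₂ :* D₁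
            numR = (Y :* P₀) :* den₁ :+ num₁ :* D
        in  ((X :* Y) :* P₁) :* (D :* den₁) :+ :- (numR :* D₁)
            := (D₂ :* Y :* P₂ :* D₁ :* D :* D₁) :* (l₂ :+ :- (A :* X :+ Λ)))
      ≋-refl XP (XP^ n) (P n) (P (suc n)) (d n) (linP (suc n)) (linP (2 ℕ.+ n))
             (constP (a (2 ℕ.+ n))) (constP (lam (2 ℕ.+ n))) (constP (b (suc n)))

  private variable
    f g : Frac
    p : Poly
    v w k : Carrier
    n m N : ℕ

  Lgen : ℕ → ℕ → Carrier
  Lgen n m = L ((1# , n , m) ∷ [])

  record LValue (f : Frac) (v : Carrier) : Set (c ⊔ ℓ) where
    field
      comb    : Comb
      expands : ⟦ comb ⟧ Expands f
      value   : L comb ≈ v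
  open LValue

  L-≈F : LValue f v → ∀ cs → ⟦ cs ⟧ ≈F f → L cs ≈ v
  L-≈F r cs e = trans (wd cs (comb r) (≈F-Expands ⟦ cs ⟧ e (expands r))) (value r)

  LValue-expand : g Expands f → LValue g v → LValue f v
  LValue-expand e r = record { comb = comb r ; expands = Expands-trans (expands r) e ; value = value r }

  LValue-≈ : v ≈ w → LValue f v → LValue f w
  LValue-≈ e r = record { comb = comb r ; expands = expands r ; value = trans (value r) e }

  LValue-self : ∀ cs → LValue ⟦ cs ⟧ (L cs)
  LValue-self cs = record { comb = cs ; expands = Expands-refl ; value = refl }

  LValue-gen : ∀ n m → LValue (gen n m) (Lgen n m)
  LValue-gen n m = record
    { comb    = (1# , n , m) ∷ []
    ; expands = Expands-≋
        (≋-trans (+P-identityʳ _) (≋-trans (*P-identityʳ _) (scaleP-identity (XP^ n *P P m))))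
        (*P-identityʳ (d m))
    ; value   = refl }

  L-linear : LValue f v → LValue g w → ∀ cs → ⟦ cs ⟧ ≈F (scaleF k f +F g) → L cs ≈ k * v + w
  L-linear {k = k} rf rg cs e = trans
    (linear k (comb rf) (comb rg) cs
      (≈F-Expands ⟦ cs ⟧ e (+F-Expands (scaleF-Expands (expands rf)) (expands rg))))
    (+-cong (*-congˡ (value rf)) (value rg))

  L-[] : L [] ≈ 0#
  L-[] = x+x≈x⇒x≈0 (L []) (sym (trans (linear 1# [] [] [] zero≈1·zero+zero) (+-congʳ (*-identityˡ _))))
    where
    zero≈1·zero+zero : ⟦ [] ⟧ ≈F (scaleF 1# ⟦ [] ⟧ +F ⟦ [] ⟧)
    zero≈1·zero+zero = []

  LValue-zero : LValue zeroF 0#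
  LValue-zero = record { comb = [] ; expands = Expands-refl ; value = L-[] }

  LValue-∷ : ∀ k n m → LValue g w → LValue (term k n m +F g) (k * Lgen n m + w)
  LValue-∷ k n m r = record
    { comb    = (k , n , m) ∷ comb r
    ; expands = +F-Expands (Expands-≋ (scaleP≋constP*P k (XP^ n *P P m)) ≋-refl) (expands r)
    ; value   = trans (L-linear (LValue-gen n m) (LValue-self (comb r)) cs (≈F-refl ⟦ cs ⟧))
                      (+-congˡ (value r)) }
    where
    cs : Comb
    cs = (k , n , m) ∷ comb r

  Lgen-orth : n < m → Lgen n m ≈ 0#
  Lgen-orth {n} {m} n<m =
    L-orth n m n<m _ (Expands-≈F (expands (LValue-gen n m)) (gen n m) (≈F-refl (gen n m)))

  Lgen-orth-absorb : ∀ k → n < m → k * Lgen n m + w ≈ w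
  Lgen-orth-absorb {n} {m} {w} k n<m = begin
    k * Lgen n m + w   ≈⟨ +-congʳ (*-congˡ (Lgen-orth n<m)) ⟩
    k * 0# + w         ≈⟨ +-congʳ (zeroʳ k) ⟩
    0# + w             ≈⟨ +-identityˡ w ⟩
    w                  ∎
    where open SetoidReasoning setoid

  LValue-∷-orth : n < m → LValue g w → LValue (term k n m +F g) w
  LValue-∷-orth {n} {m} {k = k} n<m r = LValue-≈ (Lgen-orth-absorb k n<m) (LValue-∷ k n m r)

  Lgen-diag : ∀ n → Lgen n n ≈ 1#
  Lgen-diag zero    =
    L-one _ (Expands-≈F (expands (LValue-gen 0 0)) oneF (≋⇒≈P (*P-identityʳ (oneP *P oneP))))
  Lgen-diag (suc n) = begin
    Lgen (suc n) (suc n)   ≈⟨ L-linear (LValue-gen n n) tail-value _ step ⟩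
    1# * Lgen n n + 0#     ≈⟨ +-identityʳ _ ⟩
    1# * Lgen n n          ≈⟨ *-identityˡ _ ⟩
    Lgen n n               ≈⟨ Lgen-diag n ⟩
    1#                     ∎
    where
    open SetoidReasoning setoid
    tail-value : LValue (recurrence-tail n) 0#
    tail-value = LValue-∷-orth (ℕ.n<1+n n) (LValue-∷-orth (ℕ.n<1+n (suc n))
                   (LValue-∷-orth (ℕ.m≤n⇒m≤1+n (ℕ.n<1+n n)) LValue-zero))
    step : ⟦ (1# , suc n , suc n) ∷ [] ⟧ ≈F (scaleF 1# (gen n n) +F recurrence-tail n)
    step = Expands-≈F (expands (LValue-gen (suc n) (suc n))) (scaleF 1# (gen n n) +F recurrence-tail n)
             (≈F-Expands (gen (suc n) (suc n)) (Q-recurrence n)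
               (+F-Expands {f′ = recurrence-tail n}
                           (Expands-≋ (scaleP-identity (XP^ n *P P n)) (≋-refl {d n})) Expands-refl))

  LValue-x^s*[]*Q : ∀ s N → LValue ((XP^ s *P []) *P P N , d N) 0#
  LValue-x^s*[]*Q s N = LValue-expand (Expands-≋ num≋ (*P-identityʳ (d N)))
    (LValue-≈ (trans (+-identityʳ _) (zeroˡ _)) (LValue-∷ 0# s N LValue-zero))
    where
    num≋ : (constP 0# *P (XP^ s *P P N)) *P oneP +P [] ≋ (XP^ s *P []) *P P N
    num≋ = ≋-trans (+P-identityʳ _) (≋-trans
      (*P-zero-≋ (constP 0# *P (XP^ s *P P N)) oneP (*P-zero-≋ (constP 0#) (XP^ s *P P N) 0∷[]≋[]))
      (≋-sym (*P-zero-≋ (XP^ s *P []) (P N) (*P-zeroʳ (XP^ s)))))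

  LValue-x^s*∷*Q : ∀ x p s N → LValue ((XP^ (suc s) *P p) *P P N , d N) w →
                   LValue ((XP^ s *P (x ∷ p)) *P P N , d N) (x * Lgen s N + w)
  LValue-x^s*∷*Q x p s N r = LValue-expand (by-factor (d N) num≋ ≋-refl) (LValue-∷ x s N r)
    where
    open ≋-Reasoning
    num≋ : (constP x *P (XP^ s *P P N)) *P d N +P ((XP *P XP^ s) *P p) *P P N *P d N
           ≋ ((XP^ s *P (x ∷ p)) *P P N) *P d N
    num≋ = begin
      (constP x *P (XP^ s *P P N)) *P d N +P ((XP *P XP^ s) *P p) *P P N *P d N
        ≈⟨ solve 6 (λ C Y X p Pₙ D → (C :* (Y :* Pₙ)) :* D :+ (X :* Y) :* p :* Pₙ :* D
                                     := ((Y :* (C :+ X :* p)) :* Pₙ) :* D)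
                   ≋-refl (constP x) (XP^ s) XP p (P N) (d N) ⟩
      ((XP^ s *P (constP x +P XP *P p)) *P P N) *P d N
        ≈⟨ *P-congʳ (d N) (*P-congʳ (P N) (*P-congˡ (XP^ s) (∷≋constP+XP*P x p))) ⟨
      ((XP^ s *P (x ∷ p)) *P P N) *P d N  ∎

  LValue-x^s*p*Q : ∀ p s i → i ℕ.+ s ≡ N → length p ≤ suc i →
                   LValue ((XP^ s *P p) *P P N , d N) (coeff p i)
  LValue-x^s*p*Q {N} []          s i       _      _ = LValue-x^s*[]*Q s N
  LValue-x^s*p*Q     (x ∷ [])    s zero    ≡.refl _ = LValue-≈
    (trans (+-identityʳ _) (trans (*-congˡ (Lgen-diag s)) (*-identityʳ x)))
    (LValue-x^s*∷*Q x [] s s (LValue-x^s*[]*Q (suc s) s))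
  LValue-x^s*p*Q     (x ∷ y ∷ p) s zero    _      (s≤s ())
  LValue-x^s*p*Q {N} (x ∷ p)     s (suc i) e      h = LValue-≈ (Lgen-orth-absorb x s<N)
    (LValue-x^s*∷*Q x p s N (LValue-x^s*p*Q p (suc s) i (≡.trans (ℕ.+-suc i s) e) (ℕ.≤-pred h)))
    where
    s<N : s < N
    s<N = ≡.subst (s <_) e (s≤s (ℕ.m≤n+m s i))

  LValue-*Q : Leading p N k → LValue (p *P P N , d N) k
  LValue-*Q {p} {N} h = LValue-expand (Expands-≋ (*P-congʳ (P N) (*P-identityˡ p)) (≋-refl {d N}))
    (LValue-≈ (coeff≈ h) (LValue-x^s*p*Q p 0 N (ℕ.+-identityʳ N) (length≤ h)))

  LValue-P*Q-< : n < m → LValue (P n *P P m , d m) 0#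
  LValue-P*Q-< {n} n<m = LValue-*Q (Leading-short (P n) (ℕ.≤-trans (length≤ (P-leading n)) n<m))

  LValue-P*Q-≡ : ∀ m → LValue (P m *P P m , d m) 1#
  LValue-P*Q-≡ m = LValue-*Q (P-leading m)

  LValue-P*Q-≥ : ∀ m k → m ℕ.+ k ≡ n → LValue (P n *P P m , d m) (prodA m k)
  LValue-P*Q-≥ m k ≡.refl = LValue-expand (by-factor (linProd m k) num≋ (≋-sym (d-*P-linProd m k)))
    (LValue-*Q (Leading-≈ (*-identityˡ _) (Leading-*P (P-leading m) (linProd-leading m k))))
    where
    num≋ : (P m *P linProd m k) *P P (m ℕ.+ k) ≋ (P (m ℕ.+ k) *P P m) *P linProd m k
    num≋ = solve 3 (λ Pₘ Π Pₙ → (Pₘ :* Π) :* Pₙ := (Pₙ :* Pₘ) :* Π)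
                   ≋-refl (P m) (linProd m k) (P (m ℕ.+ k))

  L-P*Q-< : ∀ n m → n < m → ∀ cs → ⟦ cs ⟧ ≈F (P n *P P m , d m) → L cs ≈ 0#
  L-P*Q-< n m n<m = L-≈F (LValue-P*Q-< n<m)

  L-P*Q-≥ : ∀ m k cs → ⟦ cs ⟧ ≈F (P (m ℕ.+ k) *P P m , d m) → L cs ≈ prodA m k
  L-P*Q-≥ m k = L-≈F (LValue-P*Q-≥ m k ≡.refl)

  L-P*Q-≤ : ∀ n m → n ≤ m → ∀ cs → ⟦ cs ⟧ ≈F (P n *P P m , d m) → L cs ≈ δ n m
  L-P*Q-≤ n m n≤m cs e with ℕ.m≤n⇒m<n∨m≡n n≤m
  ... | inj₁ n<m    = trans (L-P*Q-< n m n<m cs e) (sym (δ-≢ (ℕ.<⇒≢ n<m)))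
  ... | inj₂ ≡.refl = trans (L-≈F (LValue-P*Q-≡ n) cs e) (sym (δ-refl n))

  L-P : ∀ n cs → ⟦ cs ⟧ ≈F polyF (P n) → L cs ≈ prodA 0 n
  L-P n = L-≈F (LValue-expand (Expands-≋ (*P-identityʳ (P n)) ≋-refl) (LValue-P*Q-≥ 0 n ≡.refl))

  L-P*[Q-aQ] : ∀ n m → LValue (P n *P P (suc m) , d (suc m)) v → LValue (P n *P P m , d m) w →
               ∀ cs → ⟦ cs ⟧ ≈F (polyF (P n) *F (Q m +F scaleF (- a (suc m)) (Q (suc m)))) →
               L cs ≈ - a (suc m) * v + w
  L-P*[Q-aQ] n m r₁ r₂ cs e = L-linear r₁ r₂ cs (≈F-Expands ⟦ cs ⟧ e (Expands-≋ num≋ den≋))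
    where
    open ≋-Reasoning
    α : Carrier
    α = - a (suc m)
    num≋ : scaleP α (P n *P P (suc m)) *P d m +P (P n *P P m) *P d (suc m)
           ≋ P n *P (P m *P d (suc m) +P scaleP α (P (suc m)) *P d m)
    num≋ = begin
      scaleP α (P n *P P (suc m)) *P d m +P (P n *P P m) *P d (suc m)
        ≈⟨ +P-congʳ _ (*P-congʳ (d m) (scaleP≋constP*P α (P n *P P (suc m)))) ⟩
      (constP α *P (P n *P P (suc m))) *P d m +P (P n *P P m) *P d (suc m)
        ≈⟨ solve 6 (λ C Pₙ Pₘ₊₁ Dₘ Pₘ Dₘ₊₁ → (C :* (Pₙ :* Pₘ₊₁)) :* Dₘ :+ (Pₙ :* Pₘ) :* Dₘ₊₁
                                         := Pₙ :* (Pₘ :* Dₘ₊₁ :+ (C :* Pₘ₊₁) :* Dₘ))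
                   ≋-refl (constP α) (P n) (P (suc m)) (d m) (P m) (d (suc m)) ⟩
      P n *P (P m *P d (suc m) +P (constP α *P P (suc m)) *P d m)
        ≈⟨ *P-congˡ (P n) (+P-congˡ _ (*P-congʳ (d m) (scaleP≋constP*P α (P (suc m))))) ⟨
      P n *P (P m *P d (suc m) +P scaleP α (P (suc m)) *P d m) ∎
    den≋ : d (suc m) *P d m ≋ oneP *P (d m *P d (suc m))
    den≋ = solve 2 (λ Dₘ₊₁ Dₘ → Dₘ₊₁ :* Dₘ := con (+ 1) :* (Dₘ :* Dₘ₊₁)) ≋-refl (d (suc m)) (d m)

  x*0+y≈y : ∀ {x y} → x * 0# + y ≈ y
  x*0+y≈y {x} {y} = trans (+-congʳ (zeroʳ x)) (+-identityˡ y)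

  L-P*[Q-aQ]≈δ : ∀ n m cs → ⟦ cs ⟧ ≈F (polyF (P n) *F (Q m +F scaleF (- a (suc m)) (Q (suc m)))) →
                 L cs ≈ δ n m
  L-P*[Q-aQ]≈δ n m cs e with ℕ.<-cmp n m
  ... | tri< n<m _ _ = begin
    L cs                   ≈⟨ L-P*[Q-aQ] n m (LValue-P*Q-< (ℕ.m≤n⇒m≤1+n n<m)) (LValue-P*Q-< n<m) cs e ⟩
    - a (suc m) * 0# + 0#  ≈⟨ x*0+y≈y ⟩
    0#                     ≈⟨ δ-≢ (ℕ.<⇒≢ n<m) ⟨
    δ n m                  ∎
    where open SetoidReasoning setoid
  ... | tri≈ _ ≡.refl _ = begin
    L cs                   ≈⟨ L-P*[Q-aQ] n n (LValue-P*Q-< (ℕ.n<1+n n)) (LValue-P*Q-≡ n) cs e ⟩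
    - a (suc n) * 0# + 1#  ≈⟨ x*0+y≈y ⟩
    1#                     ≈⟨ δ-refl n ⟨
    δ n n                  ∎
    where open SetoidReasoning setoid
  ... | tri> _ _ m<n with ℕ.m≤n⇒∃[o]m+o≡n m<n
  ...   | j , 1+m+j≡n = begin
    L cs                   ≈⟨ L-P*[Q-aQ] n m (LValue-P*Q-≥ (suc m) j 1+m+j≡n)
                                 (LValue-P*Q-≥ m (suc j) (≡.trans (ℕ.+-suc m j) 1+m+j≡n)) cs e ⟩
    - α * π + α * π        ≈⟨ +-congʳ (-‿distribˡ-* α π) ⟨
    - (α * π) + α * π      ≈⟨ -‿inverseˡ (α * π) ⟩
    0#                     ≈⟨ δ-≢ (ℕ.>⇒≢ m<n) ⟨
    δ n m                  ∎
    where
    open SetoidReasoning setoid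
    α π : Carrier
    α = a (suc m)
    π = prodA (suc m) j

open import Data.Nat using (_+_)

corollary3p15 :
  ∀ {c ℓ : Level} (R : CommutativeRing c ℓ) → IsField R →
  (b a lam : ℕ → CommutativeRing.Carrier R) →
  let open CommutativeRing R hiding (_+_)
      open Over R
      open Recurrence b a lam
  in
  (∀ n → 1 ≤ n → ¬ (a n ≈ 0#)) →
  (∀ n → 1 ≤ n → ∀ y → a n * y ≈ 1# → ¬ (evalP (P n) (- (lam n * y)) ≈ 0#)) →
  (F : LinearFunctional) → IsMomentFunctional F →
  let open LinearFunctional F
  in
  (∀ n m → n < m → ∀ cs → ⟦ cs ⟧ ≈F ((P n *P P m) , d m) → L cs ≈ 0#)
  × (∀ m k cs → ⟦ cs ⟧ ≈F ((P (m + k) *P P m) , d m) → L cs ≈ prodA m k)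
  × (∀ n m → n ≤ m → ∀ cs → ⟦ cs ⟧ ≈F ((P n *P P m) , d m) → L cs ≈ δ n m)
  × (∀ n cs → ⟦ cs ⟧ ≈F polyF (P n) → L cs ≈ prodA 0 n)
  × (∀ n m cs →
       ⟦ cs ⟧ ≈F (polyF (P n) *F (Q m +F scaleF (- a (suc m)) (Q (suc m)))) →
       L cs ≈ δ n m)
-- The field and nondegeneracy hypotheses serve only the existence of 𝓛, which is given here.
corollary3p15 R _ b a lam _ _ F isM = L-P*Q-< , L-P*Q-≥ , L-P*Q-≤ , L-P , L-P*[Q-aQ]≈δ
  where open MomentFunctional R b a lam F isM
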